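{- Let $m\ge 6$. Let $H_{10}$ be the voltage graph over $\mathbb{Z}_m$ defined as follows. Take the tree with vertices $x^{*},x,x_0,x_1,x_{01},x_{10},x_{11},x_{010},x_{011},x_{101},x_{110}$ and edges $x^{*}x$, $xx_0$, $xx_1$, $x_0x_{01}$, $x_{01}x_{010}$, $x_{01}x_{011}$, $x_1x_{10}$, $x_1x_{11}$, $x_{10}x_{101}$, $x_{11}x_{110}$, an identical copy of it with every $x$ replaced by $y$, and the edge $x_0y_0$; all these edges have voltage $0$, and $x^{*},y^{*}$ are pinned. Add the labelled arcs $x_{10}\to y_{10}$ (1), $x_{11}\to y_{11}$ (2), $x_{010}\to y_{010}$ (2), $x_{010}\to y_{110}$ (1), $x_{011}\to y_{101}$ (2), $x_{011}\to y_{011}$ (3), $x_{110}\to y_{110}$ (3), $x_{110}\to y_{011}$ (1), $x_{101}\to y_{010}$ (5), $x_{101}\to y_{101}$ (3). Then the derived graph $(H_{10},m)$ has girth $10$; it is a $(3,m;10)$-graph with $2$ vertices of degree $m$ and $20m$ vertices of degree $3$.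
   Context: A voltage graph over $\mathbb{Z}_m$ is a finite directed multigraph with arc labels in $\mathbb{Z}_m$; some degree-$1$ vertices are pinned. Derived graph $(G,m)$: each non-pinned vertex $v$ gives $m$ vertices $v^0,\dots,v^{m-1}$; each pinned vertex $v^{*}$ gives a single vertex; an arc $v\to w$ labelled $a$ between non-pinned vertices gives edges $v^iw^{i+a}$ for all $i$ (indices mod $m$); an edge $v^{*}w$ with $v^{*}$ pinned gives edges $v^{*}w^i$ for all $i$. A $(3,m;g)$-graph is a graph of girth $g$ all of whose vertices have degree $3$ or $m$. -}

module Defs where

open import Data.Nat using (ℕ; zero; suc; _+_; _*_; _≤_; NonZero)
open import Data.Nat.DivMod using (_%_; m%n<n)
open import Data.Fin using (Fin; toℕ; fromℕ<; #_)
open import Data.Fin.Properties renaming (_≟_ to _≟F_)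
open import Data.Product using (Σ; _×_; _,_; proj₁; proj₂)
open import Data.Product.Properties using () renaming (≡-dec to ×-dec)
open import Data.Sum using (_⊎_; inj₁; inj₂)
open import Data.Sum.Properties using () renaming (≡-dec to ⊎-dec)
open import Data.Nat.ListAction using (sum)
open import Data.List using (List; []; _∷_; _++_; map; length; lookup; allFin; cartesianProduct)
open import Relation.Nullary using (yes; no)
open import Relation.Binary.Definitions using (DecidableEquality)
open import Relation.Binary.PropositionalEquality using (_≡_)
open import Function.Definitions using (Injective)

-- Non-pinned vertices are Fin nV, pinned vertices are Fin nP.
-- An arc (v , w , a) is an arc v → w with voltage a (read modulo m).
-- A pinned edge (p , w) is an edge between pinned vertex p and the
-- non-pinned vertex w.

record VoltageGraph : Set where
  field
    nV       : ℕ
    nP       : ℕ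
    arcs     : List (Fin nV × Fin nV × ℕ)
    pinEdges : List (Fin nP × Fin nV)

-- The derived graph (Γ , m), as a multigraph (edge set DE, endpoint map).

module Derived (Γ : VoltageGraph) (m : ℕ) .{{_ : NonZero m}} where
  open VoltageGraph Γ

  -- vertices: v^i for non-pinned v and i ∈ ℤ_m, plus one copy of each pinned vertex
  DV : Set
  DV = (Fin nV × Fin m) ⊎ Fin nP

  DE : Set
  DE = (Fin (length arcs) × Fin m) ⊎ (Fin (length pinEdges) × Fin m)

  shift : Fin m → ℕ → Fin m
  shift i a = fromℕ< (m%n<n (toℕ i + a) m)

  ends : DE → DV × DV
  ends (inj₁ (k , i)) =
    let arc = lookup arcs k in
    inj₁ (proj₁ arc , i) , inj₁ (proj₁ (proj₂ arc) , shift i (proj₂ (proj₂ arc)))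
  ends (inj₂ (k , i)) =
    let pe = lookup pinEdges k in
    inj₂ (proj₁ pe) , inj₁ (proj₂ pe , i)

  _≟V_ : DecidableEquality DV
  _≟V_ = ⊎-dec (×-dec _≟F_ _≟F_) _≟F_

  allVertices : List DV
  allVertices = map inj₁ (cartesianProduct (allFin nV) (allFin m)) ++ map inj₂ (allFin nP)

  allEdges : List DE
  allEdges = map inj₁ (cartesianProduct (allFin (length arcs)) (allFin m))
          ++ map inj₂ (cartesianProduct (allFin (length pinEdges)) (allFin m))

  ind : DV → DV → ℕ
  ind u v with u ≟V v
  ... | yes _ = 1
  ... | no  _ = 0

  -- degree: number of edge-ends at v (a loop would count twice)
  deg : DV → ℕ
  deg v = sum (map (λ e → ind (proj₁ (ends e)) v + ind (proj₂ (ends e)) v) allEdges)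

  numOfDegree : ℕ → ℕ
  numOfDegree d = sum (map (λ v → degInd (deg v)) allVertices)
    where
    degInd : ℕ → ℕ
    degInd k with k Data.Nat.≟ d
    ... | yes _ = 1
    ... | no  _ = 0

  Joins : DE → DV → DV → Set
  Joins e u v = ends e ≡ (u , v) ⊎ ends e ≡ (v , u)

  next : {n : ℕ} → Fin (suc n) → Fin (suc n)
  next {n} i = fromℕ< (m%n<n (suc (toℕ i)) (suc n))

  record Cycle (n : ℕ) : Set where
    field
      vs     : Fin (suc n) → DV
      es     : Fin (suc n) → DE
      vs-inj : Injective _≡_ _≡_ vs
      es-inj : Injective _≡_ _≡_ es
      joins  : ∀ i → Joins (es i) (vs i) (vs (next i))

  HasGirth : ℕ → Set
  HasGirth g = (Σ ℕ λ n → (suc n ≡ g) × Cycle n) × (∀ n → Cycle n → g ≤ suc n)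

  Is3mGraph : ℕ → Set
  Is3mGraph g = HasGirth g × (∀ v → deg v ≡ 3 ⊎ deg v ≡ m)

data Nm : Set where
  r n0 n1 n01 n10 n11 n010 n011 n101 n110 : Nm

-- x-copy occupies indices 0..9, y-copy 10..19
X Y : Nm → Fin 20
X r = # 0
X n0 = # 1
X n1 = # 2
X n01 = # 3
X n10 = # 4
X n11 = # 5
X n010 = # 6
X n011 = # 7
X n101 = # 8
X n110 = # 9
Y r = # 10
Y n0 = # 11
Y n1 = # 12
Y n01 = # 13
Y n10 = # 14
Y n11 = # 15
Y n010 = # 16
Y n011 = # 17
Y n101 = # 18
Y n110 = # 19

-- the tree edges (voltage 0) on one side, with r the vertex adjacent to the pinned one
treeArcs : (Nm → Fin 20) → List (Fin 20 × Fin 20 × ℕ)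
treeArcs Z =
  (Z r , Z n0 , 0) ∷ (Z r , Z n1 , 0) ∷ (Z n0 , Z n01 , 0) ∷
  (Z n01 , Z n010 , 0) ∷ (Z n01 , Z n011 , 0) ∷ (Z n1 , Z n10 , 0) ∷
  (Z n1 , Z n11 , 0) ∷ (Z n10 , Z n101 , 0) ∷ (Z n11 , Z n110 , 0) ∷ []

H10 : VoltageGraph
H10 = record
  { nV = 20
  ; nP = 2
  ; arcs = treeArcs X ++ treeArcs Y ++
      ( (X n0 , Y n0 , 0)
      ∷ (X n10 , Y n10 , 1)
      ∷ (X n11 , Y n11 , 2)
      ∷ (X n010 , Y n010 , 2)
      ∷ (X n010 , Y n110 , 1)
      ∷ (X n011 , Y n101 , 2)
      ∷ (X n011 , Y n011 , 3)
      ∷ (X n110 , Y n110 , 3)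
      ∷ (X n110 , Y n011 , 1)
      ∷ (X n101 , Y n010 , 5)
      ∷ (X n101 , Y n101 , 3)
      ∷ [])
  -- pinned vertex 0 is x*, pinned vertex 1 is y*
  ; pinEdges = (# 0 , X r) ∷ (# 1 , Y r) ∷ []
  }

-- Degrees: an unpinned vertex v^j meets exactly one lift of each arc and pin edge at v, since
-- i ↦ i + a is a bijection of ℤ_m; a pinned vertex meets all m lifts of its pin edge.
-- Girth: x* x⁰ x₀⁰ y₀⁰ y⁰ y* y¹ y₀¹ x₀¹ x¹ is a 10-cycle. A cycle of length at most 9 projects to a
-- closed non-backtracking walk of H₁₀ with at most 9 steps. If it avoids the pinned vertices its net
-- voltage, an integer, vanishes mod m; a search through all such walks shows that each of them either
-- repeats a vertex of the derived graph for every m, or closes up with net voltage in [-5, 5] ∖ {0},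
-- which is nonzero mod m because m ≥ 6. A cycle through a pinned vertex is followed from that vertex,
-- where the level is forgotten, and the search shows that no such walk returns to it within 9 steps.

module Submission where

open import Defs
open import Data.Nat using (ℕ; zero; suc; _+_; _*_; _∸_; _≤_; _<_; NonZero; >-nonZero; z≤n; s≤s; z<s)
open import Data.Nat.Properties
open import Data.Nat.DivMod using (_%_; _/_; m%n<n; %-distribˡ-+; m%n%n≡m%n; [m+kn]%n≡m%n; m<n⇒m%n≡m; m≡m%n+[m/n]*n)
open import Data.Nat.Divisibility using (_∣_; divides; ∣m+n∣m⇒∣n; n∣m*n; ∣⇒≤)
open import Data.Fin using (Fin; toℕ; fromℕ<; #_) renaming (zero to fzero; suc to fsuc)
open import Data.Fin.Properties using (toℕ-fromℕ<; toℕ-injective; toℕ<n) renaming (_≟_ to _≟ᶠ_; suc-injective to fsuc-injective; any? to anyFin?; all? to allFin?)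
open import Data.Bool using (Bool; true; if_then_else_; T; not; _∧_; _∨_)
open import Data.Maybe using (Maybe; just; nothing)
open import Data.Unit using (⊤; tt)
open import Data.Empty using (⊥)
open import Data.Product using (Σ; _×_; _,_; proj₁; proj₂)
open import Data.Product.Properties using (,-injective) renaming (≡-dec to ×-≡-dec)
open import Data.Sum using (_⊎_; inj₁; inj₂; swap)
open import Data.Sum.Properties using (inj₁-injective; inj₂-injective) renaming (≡-dec to ⊎-≡-dec)
open import Data.List using (List; []; _∷_; _++_; map; length; lookup; allFin; cartesianProduct; tabulate; upTo; filter)
open import Data.Bool.ListAction using (all)
open import Data.Bool.Properties using (T-∧; T-∨)
open import Data.List.Relation.Unary.All as All using (All; []; _∷_)
open import Data.List.Relation.Unary.All.Properties using (all⁺)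
open import Data.List.Membership.Propositional using (_∈_)
open import Data.List.Membership.Propositional.Properties using (∈-++⁺ˡ; ∈-++⁺ʳ; ∈-map⁺; ∈-filter⁺; ∈-allFin; ∈-upTo⁺)
open import Function.Bundles using (Equivalence)
open import Data.List.Relation.Unary.Any using (Any; any?)
open import Data.List.Properties using (map-++; map-∘; map-cong; map-tabulate)
open import Data.Nat.ListAction using (sum)
open import Data.Nat.ListAction.Properties using (sum-++)
open import Function using (_∘_; id; case_of_)
open import Relation.Nullary using (Dec; does; yes; no; ¬_; ¬?; contradiction; _×-dec_; _⊎-dec_; _→-dec_)
open import Relation.Nullary.Decidable using (isYes; dec-true; dec-false; toWitness; fromWitness)
open import Relation.Binary.PropositionalEquality
open import Relation.Binary using (tri<; tri≈; tri>; DecidableEquality)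
open import Data.Vec as Vec using (Vec; []; _∷_)
open import Algebra.Properties.CommutativeSemigroup +-commutativeSemigroup using (interchange)
open ≡-Reasoning

-- Arithmetic in ℤ_n

[m%n+o]%n≡[m+o]%n : ∀ m o n .{{_ : NonZero n}} → (m % n + o) % n ≡ (m + o) % n
[m%n+o]%n≡[m+o]%n m o n = begin
  (m % n + o) % n          ≡⟨ %-distribˡ-+ (m % n) o n ⟩
  (m % n % n + o % n) % n  ≡⟨ cong (λ x → (x + o % n) % n) (m%n%n≡m%n m n) ⟩
  (m % n + o % n) % n      ≡⟨ %-distribˡ-+ m o n ⟨
  (m + o) % n              ∎

[m+o]%n≡m%n⇒n∣o : ∀ m o n .{{_ : NonZero n}} → (m + o) % n ≡ m % n → n ∣ o
[m+o]%n≡m%n⇒n∣o m o n eq = ∣m+n∣m⇒∣n (divides ((m + o) / n) (+-cancelˡ-≡ (m % n) _ _ split)) (n∣m*n (m / n))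
  where
  split : m % n + (m / n * n + o) ≡ m % n + (m + o) / n * n
  split = begin
    m % n + (m / n * n + o)    ≡⟨ +-assoc (m % n) (m / n * n) o ⟨
    m % n + m / n * n + o      ≡⟨ cong (_+ o) (m≡m%n+[m/n]*n m n) ⟨
    m + o                      ≡⟨ m≡m%n+[m/n]*n (m + o) n ⟩
    (m + o) % n + (m + o) / n * n ≡⟨ cong (_+ (m + o) / n * n) eq ⟩
    m % n + (m + o) / n * n    ∎

m≤n∧n<m+o⇒n∸m<o : ∀ {m n o} → m ≤ n → n < m + o → n ∸ m < o
m≤n∧n<m+o⇒n∸m<o {m} m≤n n<m+o = +-cancelˡ-< m _ _ (subst (_< m + _) (sym (m+[n∸m]≡n m≤n)) n<m+o)

m+[n∸m%n]≡[1+m/n]*n : ∀ m n .{{_ : NonZero n}} → m + (n ∸ m % n) ≡ suc (m / n) * n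
m+[n∸m%n]≡[1+m/n]*n m n = begin
  m + (n ∸ m % n)                    ≡⟨ cong (_+ (n ∸ m % n)) (trans (m≡m%n+[m/n]*n m n) (+-comm (m % n) _)) ⟩
  m / n * n + m % n + (n ∸ m % n)    ≡⟨ +-assoc (m / n * n) (m % n) _ ⟩
  m / n * n + (m % n + (n ∸ m % n))  ≡⟨ cong (m / n * n +_) (m+[n∸m]≡n (m%n≤n m n)) ⟩
  m / n * n + n                      ≡⟨ +-comm (m / n * n) n ⟩
  suc (m / n) * n                    ∎
  where open Data.Nat.DivMod using (m%n≤n)

module _ {n : ℕ} .{{_ : NonZero n}} where

  infixl 6 _+ₘ_ _-ₘ_

  -- literally the definition of Derived.shift, so the two agree definitionally
  _+ₘ_ : Fin n → ℕ → Fin n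
  i +ₘ a = fromℕ< (m%n<n (toℕ i + a) n)

  _-ₘ_ : Fin n → ℕ → Fin n
  j -ₘ a = j +ₘ (n ∸ a % n)

  toℕ-+ₘ : ∀ i a → toℕ (i +ₘ a) ≡ (toℕ i + a) % n
  toℕ-+ₘ i a = toℕ-fromℕ< _

  +ₘ-assoc : ∀ i a b → i +ₘ a +ₘ b ≡ i +ₘ (a + b)
  +ₘ-assoc i a b = toℕ-injective (begin
    toℕ (i +ₘ a +ₘ b)          ≡⟨ toℕ-+ₘ (i +ₘ a) b ⟩
    (toℕ (i +ₘ a) + b) % n     ≡⟨ cong (λ x → (x + b) % n) (toℕ-+ₘ i a) ⟩
    ((toℕ i + a) % n + b) % n  ≡⟨ [m%n+o]%n≡[m+o]%n (toℕ i + a) b n ⟩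
    (toℕ i + a + b) % n        ≡⟨ cong (_% n) (+-assoc (toℕ i) a b) ⟩
    (toℕ i + (a + b)) % n      ≡⟨ toℕ-+ₘ i (a + b) ⟨
    toℕ (i +ₘ (a + b))         ∎)

  +ₘ-multiple : ∀ i k → i +ₘ k * n ≡ i
  +ₘ-multiple i k = toℕ-injective (begin
    toℕ (i +ₘ k * n)      ≡⟨ toℕ-+ₘ i (k * n) ⟩
    (toℕ i + k * n) % n   ≡⟨ [m+kn]%n≡m%n (toℕ i) k n ⟩
    toℕ i % n             ≡⟨ m<n⇒m%n≡m (toℕ<n i) ⟩
    toℕ i                 ∎)

  +ₘ-identityʳ : ∀ i → i +ₘ 0 ≡ i
  +ₘ-identityʳ i = +ₘ-multiple i 0

  +ₘ-ₘ : ∀ i a → i +ₘ a -ₘ a ≡ i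
  +ₘ-ₘ i a = begin
    i +ₘ a +ₘ (n ∸ a % n)     ≡⟨ +ₘ-assoc i a _ ⟩
    i +ₘ (a + (n ∸ a % n))    ≡⟨ cong (i +ₘ_) (m+[n∸m%n]≡[1+m/n]*n a n) ⟩
    i +ₘ suc (a / n) * n      ≡⟨ +ₘ-multiple i (suc (a / n)) ⟩
    i                         ∎

  -ₘ+ₘ : ∀ j a → j -ₘ a +ₘ a ≡ j
  -ₘ+ₘ j a = begin
    j +ₘ (n ∸ a % n) +ₘ a     ≡⟨ +ₘ-assoc j _ a ⟩
    j +ₘ ((n ∸ a % n) + a)    ≡⟨ cong (j +ₘ_) (trans (+-comm _ a) (m+[n∸m%n]≡[1+m/n]*n a n)) ⟩
    j +ₘ suc (a / n) * n      ≡⟨ +ₘ-multiple j (suc (a / n)) ⟩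
    j                         ∎

  +ₘ-cancelʳ : ∀ {i i′} a → i +ₘ a ≡ i′ +ₘ a → i ≡ i′
  +ₘ-cancelʳ {i} {i′} a eq = begin
    i              ≡⟨ +ₘ-ₘ i a ⟨
    i +ₘ a -ₘ a    ≡⟨ cong (_-ₘ a) eq ⟩
    i′ +ₘ a -ₘ a   ≡⟨ +ₘ-ₘ i′ a ⟩
    i′             ∎

  +ₘ-≢ : ∀ i {d} → 0 < d → d < n → i +ₘ d ≢ i
  +ₘ-≢ i {d} 0<d d<n eq = <⇒≱ d<n (∣⇒≤ {{>-nonZero 0<d}} n∣d)
    where
    n∣d : n ∣ d
    n∣d = [m+o]%n≡m%n⇒n∣o (toℕ i) d n (begin
      (toℕ i + d) % n   ≡⟨ toℕ-+ₘ i d ⟨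
      toℕ (i +ₘ d)      ≡⟨ cong toℕ eq ⟩
      toℕ i             ≡⟨ m<n⇒m%n≡m (toℕ<n i) ⟨
      toℕ i % n         ∎)

  +ₘ-distinct : ∀ i {a b} → a < b → b ∸ a < n → i +ₘ a ≢ i +ₘ b
  +ₘ-distinct i {a} {b} a<b b∸a<n eq = +ₘ-≢ (i +ₘ a) (m<n⇒0<n∸m a<b) b∸a<n (begin
    i +ₘ a +ₘ (b ∸ a)   ≡⟨ +ₘ-assoc i a (b ∸ a) ⟩
    i +ₘ (a + (b ∸ a))  ≡⟨ cong (i +ₘ_) (m+[n∸m]≡n (<⇒≤ a<b)) ⟩
    i +ₘ b              ≡⟨ eq ⟨
    i +ₘ a              ∎)

indicator : ∀ {A : Set} → Dec A → ℕ
indicator a? = if does a? then 1 else 0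

indicator-yes : ∀ {A : Set} (a? : Dec A) → A → indicator a? ≡ 1
indicator-yes a? a rewrite dec-true a? a = refl

indicator-no : ∀ {A : Set} (a? : Dec A) → ¬ A → indicator a? ≡ 0
indicator-no a? ¬a rewrite dec-false a? ¬a = refl

∑ : ∀ {k} → (Fin k → ℕ) → ℕ
∑ {zero} f = 0
∑ {suc k} f = f fzero + ∑ (f ∘ fsuc)

sum-map-allFin : ∀ {k} (f : Fin k → ℕ) → sum (map f (allFin k)) ≡ ∑ f
sum-map-allFin {zero} f = refl
sum-map-allFin {suc k} f = cong (f fzero +_) (begin
  sum (map f (tabulate fsuc))        ≡⟨ cong sum (map-tabulate fsuc f) ⟩
  sum (tabulate (f ∘ fsuc))          ≡⟨ cong sum (map-tabulate id (f ∘ fsuc)) ⟨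
  sum (map (f ∘ fsuc) (allFin k))    ≡⟨ sum-map-allFin (f ∘ fsuc) ⟩
  ∑ (f ∘ fsuc)                       ∎)

∑-cong : ∀ {k} {f g : Fin k → ℕ} → (∀ i → f i ≡ g i) → ∑ f ≡ ∑ g
∑-cong {zero} f≗g = refl
∑-cong {suc k} f≗g = cong₂ _+_ (f≗g fzero) (∑-cong (f≗g ∘ fsuc))

∑-zero : ∀ {k} (f : Fin k → ℕ) → (∀ i → f i ≡ 0) → ∑ f ≡ 0
∑-zero {zero} f f≡0 = refl
∑-zero {suc k} f f≡0 = cong₂ _+_ (f≡0 fzero) (∑-zero (f ∘ fsuc) (f≡0 ∘ fsuc))

∑-single : ∀ {k} (f : Fin k → ℕ) i₀ → f i₀ ≡ 1 → (∀ i → i ≢ i₀ → f i ≡ 0) → ∑ f ≡ 1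
∑-single f fzero fi₀≡1 rest = cong₂ _+_ fi₀≡1 (∑-zero (f ∘ fsuc) (λ i → rest (fsuc i) λ ()))
∑-single f (fsuc i₀) fi₀≡1 rest =
  cong₂ _+_ (rest fzero λ ()) (∑-single (f ∘ fsuc) i₀ fi₀≡1 (λ i i≢i₀ → rest (fsuc i) (i≢i₀ ∘ fsuc-injective)))

∑-const : ∀ k c → ∑ {k} (λ _ → c) ≡ k * c
∑-const zero c = refl
∑-const (suc k) c = cong (c +_) (∑-const k c)

∑-+ : ∀ {k} (f g : Fin k → ℕ) → ∑ (λ i → f i + g i) ≡ ∑ f + ∑ g
∑-+ {zero} f g = refl
∑-+ {suc k} f g = trans (cong (f fzero + g fzero +_) (∑-+ (f ∘ fsuc) (g ∘ fsuc))) (interchange (f fzero) (g fzero) _ _)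

∑-*ˡ : ∀ {k} c (f : Fin k → ℕ) → ∑ (λ i → c * f i) ≡ c * ∑ f
∑-*ˡ {zero} c f = sym (*-zeroʳ c)
∑-*ˡ {suc k} c f = trans (cong (c * f fzero +_) (∑-*ˡ c (f ∘ fsuc))) (sym (*-distribˡ-+ c (f fzero) _))

sum-map-++ : ∀ {A : Set} (f : A → ℕ) xs ys → sum (map f (xs ++ ys)) ≡ sum (map f xs) + sum (map f ys)
sum-map-++ f xs ys = trans (cong sum (map-++ f xs ys)) (sum-++ (map f xs) (map f ys))

sum-map-cartesianProduct : ∀ {A B : Set} (f : A × B → ℕ) xs ys →
  sum (map f (cartesianProduct xs ys)) ≡ sum (map (λ x → sum (map (λ y → f (x , y)) ys)) xs)
sum-map-cartesianProduct f [] ys = refl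
sum-map-cartesianProduct f (x ∷ xs) ys = begin
  sum (map f (map (x ,_) ys ++ cartesianProduct xs ys))             ≡⟨ sum-map-++ f (map (x ,_) ys) _ ⟩
  sum (map f (map (x ,_) ys)) + sum (map f (cartesianProduct xs ys)) ≡⟨ cong₂ _+_ (cong sum (sym (map-∘ ys))) (sum-map-cartesianProduct f xs ys) ⟩
  sum (map (λ y → f (x , y)) ys) + sum (map (λ x → sum (map (λ y → f (x , y)) ys)) xs) ∎

sum-map-allFin² : ∀ {k l} (f : Fin k × Fin l → ℕ) →
  sum (map f (cartesianProduct (allFin k) (allFin l))) ≡ ∑ (λ x → ∑ (λ y → f (x , y)))
sum-map-allFin² {k} {l} f = begin
  sum (map f (cartesianProduct (allFin k) (allFin l)))              ≡⟨ sum-map-cartesianProduct f (allFin k) (allFin l) ⟩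
  sum (map (λ x → sum (map (λ y → f (x , y)) (allFin l))) (allFin k)) ≡⟨ sum-map-allFin (λ x → sum (map (λ y → f (x , y)) (allFin l))) ⟩
  ∑ (λ x → sum (map (λ y → f (x , y)) (allFin l)))                   ≡⟨ ∑-cong (λ x → sum-map-allFin (λ y → f (x , y))) ⟩
  ∑ (λ x → ∑ (λ y → f (x , y)))                                     ∎

-- Degrees in a derived graph

module Graph (Γ : VoltageGraph) where
  open VoltageGraph Γ

  Arc PinEdge : Set
  Arc = Fin (length arcs)
  PinEdge = Fin (length pinEdges)

  tail head : Arc → Fin nV
  tail k = proj₁ (lookup arcs k)
  head k = proj₁ (proj₂ (lookup arcs k))

  voltage : Arc → ℕ
  voltage k = proj₂ (proj₂ (lookup arcs k))

  pinOf : PinEdge → Fin nP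
  pinOf k = proj₁ (lookup pinEdges k)

  anchor : PinEdge → Fin nV
  anchor k = proj₂ (lookup pinEdges k)

  Loopless : Set
  Loopless = ∀ k → tail k ≢ head k

  baseDegree : Fin nV → ℕ
  baseDegree v = ∑ (λ k → indicator (tail k ≟ᶠ v) + indicator (head k ≟ᶠ v)) + ∑ (λ k → indicator (anchor k ≟ᶠ v))

  pinDegree : Fin nP → ℕ
  pinDegree P = ∑ (λ k → indicator (pinOf k ≟ᶠ P))

module Degrees (Γ : VoltageGraph) (m : ℕ) .{{_ : NonZero m}} where
  open VoltageGraph Γ
  open Graph Γ
  open Derived Γ m

  ind-yes : ∀ {u v} → u ≡ v → ind u v ≡ 1
  ind-yes {u} {v} u≡v with u ≟V v
  ... | yes _ = refl
  ... | no u≢v = contradiction u≡v u≢v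

  ind-no : ∀ {u v} → u ≢ v → ind u v ≡ 0
  ind-no {u} {v} u≢v with u ≟V v
  ... | yes u≡v = contradiction u≡v u≢v
  ... | no _ = refl

  ind≡indicator : ∀ {u v} {A : Set} (a? : Dec A) → (u ≡ v → A) → (A → u ≡ v) → ind u v ≡ indicator a?
  ind≡indicator (yes a) _ from = ind-yes (from a)
  ind≡indicator (no ¬a) to _ = ind-no (¬a ∘ to)

  ∑-ind-levels : ∀ {w v} (w≟v : Dec (w ≡ v)) j (g : Fin m → Fin m) i₀ → g i₀ ≡ j → (∀ i → g i ≡ j → i ≡ i₀) →
    ∑ (λ i → ind (inj₁ (w , g i)) (inj₁ (v , j))) ≡ indicator w≟v
  ∑-ind-levels (yes refl) j g i₀ gi₀≡j unique = ∑-single {m} _ i₀ (ind-yes (cong (λ i → inj₁ (_ , i)) gi₀≡j))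
    (λ i i≢i₀ → ind-no (i≢i₀ ∘ unique i ∘ proj₂ ∘ ,-injective ∘ inj₁-injective))
  ∑-ind-levels (no w≢v) j g _ _ _ = ∑-zero {m} _ (λ i → ind-no (w≢v ∘ proj₁ ∘ ,-injective ∘ inj₁-injective))

  sum-allEdges : (φ : DE → ℕ) →
    sum (map φ allEdges) ≡ ∑ (λ k → ∑ (λ i → φ (inj₁ (k , i)))) + ∑ (λ k → ∑ (λ i → φ (inj₂ (k , i))))
  sum-allEdges φ = trans (sum-map-++ φ (map inj₁ arcLevels) (map inj₂ pinLevels)) (cong₂ _+_
    (trans (cong sum (sym (map-∘ arcLevels))) (sum-map-allFin² (φ ∘ inj₁)))
    (trans (cong sum (sym (map-∘ pinLevels))) (sum-map-allFin² (φ ∘ inj₂))))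
    where
    arcLevels = cartesianProduct (allFin (length arcs)) (allFin m)
    pinLevels = cartesianProduct (allFin (length pinEdges)) (allFin m)

  sum-allVertices : (φ : DV → ℕ) →
    sum (map φ allVertices) ≡ ∑ (λ v → ∑ (λ i → φ (inj₁ (v , i)))) + ∑ (λ P → φ (inj₂ P))
  sum-allVertices φ = trans (sum-map-++ φ (map inj₁ levels) (map inj₂ (allFin nP))) (cong₂ _+_
    (trans (cong sum (sym (map-∘ levels))) (sum-map-allFin² (φ ∘ inj₁)))
    (trans (cong sum (sym (map-∘ (allFin nP)))) (sum-map-allFin (φ ∘ inj₂))))
    where
    levels = cartesianProduct (allFin nV) (allFin m)

  deg-unpinned : ∀ v j → deg (inj₁ (v , j)) ≡ baseDegree v
  deg-unpinned v j = trans (sum-allEdges _) (cong₂ _+_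
    (∑-cong λ k → trans (∑-+ {m} _ _) (cong₂ _+_
      (∑-ind-levels (tail k ≟ᶠ v) j id j refl (λ _ → id))
      (∑-ind-levels (head k ≟ᶠ v) j (_+ₘ voltage k) (j -ₘ voltage k) (-ₘ+ₘ j _)
        (λ i i+a≡j → trans (sym (+ₘ-ₘ i _)) (cong (_-ₘ voltage k) i+a≡j)))))
    (∑-cong λ k → ∑-ind-levels (anchor k ≟ᶠ v) j id j refl (λ _ → id)))

  deg-pinned : ∀ P → deg (inj₂ P) ≡ m * pinDegree P
  deg-pinned P = begin
    deg (inj₂ P)                                        ≡⟨ sum-allEdges _ ⟩
    ∑ (λ (_ : Arc) → ∑ (λ (_ : Fin m) → 0)) + ∑ (λ k → ∑ (λ (_ : Fin m) → ind (inj₂ (pinOf k)) (inj₂ P) + 0))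
      ≡⟨ cong₂ _+_ (∑-zero {length arcs} _ (λ _ → trans (∑-const m 0) (*-zeroʳ m)))
                   (∑-cong λ k → trans (∑-const m _) (cong (m *_) (trans (+-identityʳ _) (pinned-ind k)))) ⟩
    ∑ (λ k → m * indicator (pinOf k ≟ᶠ P))              ≡⟨ ∑-*ˡ {length pinEdges} m _ ⟩
    m * pinDegree P                                     ∎
    where
    pinned-ind : ∀ k → ind (inj₂ (pinOf k)) (inj₂ P) ≡ indicator (pinOf k ≟ᶠ P)
    pinned-ind k = ind≡indicator (pinOf k ≟ᶠ P) inj₂-injective (cong inj₂)

  numOfDegree-≡ : ∀ d → numOfDegree d ≡ sum (map (λ v → indicator (deg v ≟ d)) allVertices)
  numOfDegree-≡ d = trans (proj₂ unfolded) (cong sum (map-cong pointwise allVertices))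
    where
    -- the indicator used by numOfDegree is local to its definition; unification names it
    unfolded : Σ (DV → ℕ) λ δ → numOfDegree d ≡ sum (map δ allVertices)
    unfolded = _ , refl
    pointwise : ∀ v → proj₁ unfolded v ≡ indicator (deg v ≟ d)
    pointwise v with deg v
    ... | k with k ≟ d
    ...   | yes k≡d = sym (indicator-yes (k ≟ d) k≡d)
    ...   | no k≢d = sym (indicator-no (k ≟ d) k≢d)

  numOfDegree-uniform : ∀ {a b} d → (∀ v j → deg (inj₁ (v , j)) ≡ a) → (∀ P → deg (inj₂ P) ≡ b) →
    numOfDegree d ≡ nV * (m * indicator (a ≟ d)) + nP * indicator (b ≟ d)
  numOfDegree-uniform {a} {b} d degᵥ degₚ = begin
    numOfDegree d                                          ≡⟨ numOfDegree-≡ d ⟩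
    sum (map (λ v → indicator (deg v ≟ d)) allVertices)    ≡⟨ sum-allVertices _ ⟩
    ∑ (λ v → ∑ (λ i → indicator (deg (inj₁ (v , i)) ≟ d))) + ∑ (λ P → indicator (deg (inj₂ P) ≟ d))
      ≡⟨ cong₂ _+_ (∑-cong λ v → ∑-cong λ i → cong (λ k → indicator (k ≟ d)) (degᵥ v i))
                   (∑-cong λ P → cong (λ k → indicator (k ≟ d)) (degₚ P)) ⟩
    ∑ (λ (_ : Fin nV) → ∑ (λ (_ : Fin m) → indicator (a ≟ d))) + ∑ (λ (_ : Fin nP) → indicator (b ≟ d))
      ≡⟨ cong₂ _+_ (trans (∑-cong {nV} λ _ → ∑-const m (indicator (a ≟ d))) (∑-const nV _)) (∑-const nP _) ⟩
    nV * (m * indicator (a ≟ d)) + nP * indicator (b ≟ d) ∎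

-- A search for short cycles

data Dart : Set where
  forward backward : (arc otherEnd voltage : ℕ) → Dart
  outward : (pinEdge pinned : ℕ) → Dart

EdgeCode : Set
EdgeCode = ℕ ⊎ ℕ

edgeCode : Dart → EdgeCode
edgeCode (forward k _ _) = inj₁ k
edgeCode (backward k _ _) = inj₁ k
edgeCode (outward k _) = inj₂ k

Fresh : EdgeCode → Maybe EdgeCode → Set
Fresh e nothing = ⊤
Fresh e (just e′) = e ≢ e′

fresh? : ∀ e l → Dec (Fresh e l)
fresh? e nothing = yes tt
fresh? e (just e′) = ¬? (⊎-≡-dec _≟_ _≟_ e e′)

-- (p , q) is the net voltage p − q of a walk.
Offset : Set
Offset = ℕ × ℕ

_↑_ _↓_ : Offset → ℕ → Offset
(p , q) ↑ a = p + a , q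
(p , q) ↓ a = p , q + a

SameOffset : Offset → Offset → Set
SameOffset (p , q) (p′ , q′) = p + q′ ≡ p′ + q

data Start : Set where
  at pin : ℕ → Start

_‼_ : List (List Dart) → ℕ → List Dart
[] ‼ _ = []
(ds ∷ dss) ‼ zero = ds
(ds ∷ dss) ‼ suc c = dss ‼ c

-- Vertices, edges and pinned vertices are coded by natural numbers. The adjacency lists are a
-- parameter, rather than computed inside the search, so that evaluation computes them once.
module Search (M : ℕ) (adjacency : List (List Dart)) (pinTable : List (ℕ × ℕ × ℕ)) where

  -- p − q is nonzero modulo every m ≥ M.
  Apart : Offset → Set
  Apart (p , q) = p ≢ q × p < q + M × q < p + M

  closes : Start → ℕ → Offset → Bool
  closes (at c₀) c (p , q) = isYes (c ≟ c₀ →-dec ¬? (p ≟ q) ×-dec p <? q + M ×-dec q <? p + M)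
  closes (pin _) c o = true

  -- The same base vertex at the same offset is the same vertex of the derived graph, whatever m is.
  revisits : ℕ → Offset → List (ℕ × Offset) → Bool
  revisits c (p , q) h = isYes (any? (λ (u , p′ , q′) → c ≟ u ×-dec p + q′ ≟ p′ + q) h)

  mutual
    explore : Start → ℕ → ℕ → Maybe EdgeCode → Offset → List (ℕ × Offset) → Bool
    explore s zero c l o h = true
    explore s (suc f) c l o h = all (λ d → not (isYes (fresh? (edgeCode d) l)) ∨ follow s f d o h) (adjacency ‼ c)

    follow : Start → ℕ → Dart → Offset → List (ℕ × Offset) → Bool
    follow s f (forward k w a) o h = arrive s f w (inj₁ k) (o ↑ a) h
    follow s f (backward k w a) o h = arrive s f w (inj₁ k) (o ↓ a) h
    follow s f (outward k P) o h = arrivePinned s f P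

    arrive : Start → ℕ → ℕ → EdgeCode → Offset → List (ℕ × Offset) → Bool
    arrive s f c e o h = closes s c o ∧ (revisits c o h ∨ explore s f c (just e) o ((c , o) ∷ h))

    -- A search started at an unpinned vertex only accounts for cycles avoiding the pinned vertices;
    -- leaving a pinned vertex, offsets and history start afresh.
    arrivePinned : Start → ℕ → ℕ → Bool
    arrivePinned (at _) f P = true
    arrivePinned (pin P₀) f P = not (isYes (P ≟ P₀)) ∧ leavePinned (pin P₀) f P

    leavePinned : Start → ℕ → ℕ → Bool
    leavePinned s zero P = true
    leavePinned s (suc f) P = all (λ (k , P′ , w) → not (isYes (P′ ≟ P)) ∨ arrive s f w (inj₂ k) (0 , 0) []) pinTable

  T-not : ∀ {b} → T (not b) → ¬ T b
  T-not {true} () _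

  explore-follow : ∀ {s f c l o h d} → T (explore s (suc f) c l o h) → d ∈ adjacency ‼ c →
    Fresh (edgeCode d) l → T (follow s f d o h)
  explore-follow {l = l} {d = d} ex d∈ fresh with Equivalence.to T-∨ (All.lookup (all⁺ _ _ ex) d∈)
  ... | inj₁ stale = contradiction (fromWitness {a? = fresh? (edgeCode d) l} fresh) (T-not stale)
  ... | inj₂ next = next

  arrive-closes : ∀ {s f c e o h} → T (arrive s f c e o h) → T (closes s c o)
  arrive-closes = proj₁ ∘ Equivalence.to T-∧

  arrive-continues : ∀ {s f c e o h} → T (arrive s f c e o h) →
    T (revisits c o h) ⊎ T (explore s f c (just e) o ((c , o) ∷ h))
  arrive-continues = Equivalence.to T-∨ ∘ proj₂ ∘ Equivalence.to T-∧

  closes-at : ∀ {c₀ c o} → T (closes (at c₀) c o) → c ≡ c₀ → Apart o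
  closes-at = toWitness

  revisits-sound : ∀ {c o h} → T (revisits c o h) → Any (λ (u , o′) → c ≡ u × SameOffset o o′) h
  revisits-sound = toWitness

  arrivePinned-pin : ∀ {P₀ f P} → T (arrivePinned (pin P₀) f P) → P ≢ P₀ × T (leavePinned (pin P₀) f P)
  arrivePinned-pin {P₀} {f} {P} t with Equivalence.to T-∧ t
  ... | P≢P₀ , leave = T-not P≢P₀ ∘ fromWitness , leave

  leavePinned-arrive : ∀ {s f P k w} → T (leavePinned s (suc f) P) → (k , P , w) ∈ pinTable →
    T (arrive s f w (inj₂ k) (0 , 0) [])
  leavePinned-arrive {P = P} leave k∈ with Equivalence.to T-∨ (All.lookup (all⁺ _ _ leave) k∈)
  ... | inj₁ other = contradiction (fromWitness {a? = P ≟ P} refl) (T-not other)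
  ... | inj₂ next = next

  noShortCycle : ℕ → ℕ → ℕ → Bool
  noShortCycle nV nP n = all (λ c → explore (at c) n c nothing (0 , 0) ((c , (0 , 0)) ∷ [])) (upTo nV)
                       ∧ all (λ P → leavePinned (pin P) n P) (upTo nP)

module Coding (Γ : VoltageGraph) where
  open VoltageGraph Γ
  open Graph Γ

  forwardDart backwardDart : Arc → Dart
  forwardDart k = forward (toℕ k) (toℕ (head k)) (voltage k)
  backwardDart k = backward (toℕ k) (toℕ (tail k)) (voltage k)

  outwardDart : PinEdge → Dart
  outwardDart k = outward (toℕ k) (toℕ (pinOf k))

  outArcs inArcs : Fin nV → List Arc
  outArcs v = filter (λ k → tail k ≟ᶠ v) (allFin _)
  inArcs v = filter (λ k → head k ≟ᶠ v) (allFin _)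

  pinEdgesAt : Fin nV → List PinEdge
  pinEdgesAt v = filter (λ k → anchor k ≟ᶠ v) (allFin _)

  darts : Fin nV → List Dart
  darts v = map forwardDart (outArcs v) ++ map backwardDart (inArcs v) ++ map outwardDart (pinEdgesAt v)

  pinTable : List (ℕ × ℕ × ℕ)
  pinTable = map (λ k → toℕ k , toℕ (pinOf k) , toℕ (anchor k)) (allFin _)

  NoShortCycle : ℕ → ℕ → Set
  NoShortCycle M n = T (Search.noShortCycle M (tabulate darts) pinTable nV nP n)

  ‼-tabulate : ∀ {k} (f : Fin k → List Dart) i → tabulate f ‼ toℕ i ≡ f i
  ‼-tabulate f fzero = refl
  ‼-tabulate f (fsuc i) = ‼-tabulate (f ∘ fsuc) i

  forward∈ : ∀ {v} k → tail k ≡ v → forwardDart k ∈ tabulate darts ‼ toℕ v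
  forward∈ {v} k tk≡v = subst (_ ∈_) (sym (‼-tabulate darts v))
    (∈-++⁺ˡ (∈-map⁺ forwardDart (∈-filter⁺ (λ k → tail k ≟ᶠ v) (∈-allFin k) tk≡v)))

  backward∈ : ∀ {v} k → head k ≡ v → backwardDart k ∈ tabulate darts ‼ toℕ v
  backward∈ {v} k hk≡v = subst (_ ∈_) (sym (‼-tabulate darts v))
    (∈-++⁺ʳ (map forwardDart (outArcs v))
      (∈-++⁺ˡ (∈-map⁺ backwardDart (∈-filter⁺ (λ k → head k ≟ᶠ v) (∈-allFin k) hk≡v))))

  outward∈ : ∀ {v} k → anchor k ≡ v → outwardDart k ∈ tabulate darts ‼ toℕ v
  outward∈ {v} k ak≡v = subst (_ ∈_) (sym (‼-tabulate darts v))
    (∈-++⁺ʳ (map forwardDart (outArcs v)) (∈-++⁺ʳ (map backwardDart (inArcs v))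
      (∈-map⁺ outwardDart (∈-filter⁺ (λ k → anchor k ≟ᶠ v) (∈-allFin k) ak≡v))))

  pinTable∈ : ∀ k → (toℕ k , toℕ (pinOf k) , toℕ (anchor k)) ∈ pinTable
  pinTable∈ k = ∈-map⁺ (λ k → toℕ k , toℕ (pinOf k) , toℕ (anchor k)) (∈-allFin k)

-- Soundness of the search

module Girth (Γ : VoltageGraph) (m : ℕ) .{{_ : NonZero m}} where
  open VoltageGraph Γ
  open Graph Γ
  open Coding Γ
  open Derived Γ m

  data Step (v : Fin nV) (j : Fin m) : DE → DV → Set where
    along   : ∀ k → tail k ≡ v → Step v j (inj₁ (k , j)) (inj₁ (head k , j +ₘ voltage k))
    against : ∀ k i → head k ≡ v → i +ₘ voltage k ≡ j → Step v j (inj₁ (k , i)) (inj₁ (tail k , i))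
    exit    : ∀ k → anchor k ≡ v → Step v j (inj₂ (k , j)) (inj₂ (pinOf k))

  step : ∀ {v j E u} → Joins E (inj₁ (v , j)) u → Step v j E u
  step {E = inj₁ (k , i)} (inj₁ refl) = along k refl
  step {E = inj₁ (k , i)} (inj₂ refl) = against k i refl refl
  step {E = inj₂ _} (inj₁ ())
  step {E = inj₂ (k , i)} (inj₂ refl) = exit k refl

  data Entry (P : Fin nP) : DE → DV → Set where
    enter : ∀ k i → pinOf k ≡ P → Entry P (inj₂ (k , i)) (inj₁ (anchor k , i))

  entry : ∀ {P E u} → Joins E (inj₂ P) u → Entry P E u
  entry {E = inj₁ _} (inj₁ ())
  entry {E = inj₁ _} (inj₂ ())
  entry {E = inj₂ (k , i)} (inj₁ refl) = enter k i refl
  entry {E = inj₂ _} (inj₂ ())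

  codeOf : DE → EdgeCode
  codeOf (inj₁ (k , _)) = inj₁ (toℕ k)
  codeOf (inj₂ (k , _)) = inj₂ (toℕ k)

  dartOf : ∀ {v j E u} → Step v j E u → Dart
  dartOf (along k _) = forwardDart k
  dartOf (against k _ _ _) = backwardDart k
  dartOf (exit k _) = outwardDart k

  dartOf∈ : ∀ {v j E u} (st : Step v j E u) → dartOf st ∈ tabulate darts ‼ toℕ v
  dartOf∈ (along k tk≡v) = forward∈ k tk≡v
  dartOf∈ (against k _ hk≡v _) = backward∈ k hk≡v
  dartOf∈ (exit k ak≡v) = outward∈ k ak≡v

  step-unique : Loopless → ∀ {v j E E′ u u′} → Step v j E u → Step v j E′ u′ → codeOf E ≡ codeOf E′ → E ≡ E′
  step-unique loopless (along k _) (along k′ _) eq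
    with refl ← toℕ-injective (inj₁-injective eq) = refl
  step-unique loopless (along k tk≡v) (against k′ _ hk′≡v _) eq
    with refl ← toℕ-injective (inj₁-injective eq) = contradiction (trans tk≡v (sym hk′≡v)) (loopless k)
  step-unique loopless (against k _ hk≡v _) (along k′ tk′≡v) eq
    with refl ← toℕ-injective (inj₁-injective eq) = contradiction (trans tk′≡v (sym hk≡v)) (loopless k)
  step-unique loopless (against k i _ i+a≡j) (against k′ i′ _ i′+a≡j) eq
    with refl ← toℕ-injective (inj₁-injective eq) = cong (λ i → inj₁ (k , i)) (+ₘ-cancelʳ (voltage k) (trans i+a≡j (sym i′+a≡j)))
  step-unique loopless (exit k _) (exit k′ _) eq
    with refl ← toℕ-injective (inj₂-injective eq) = refl

  data At (j₀ : Fin m) : Offset → Fin m → Set where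
    offset : ∀ {p q j} → j +ₘ q ≡ j₀ +ₘ p → At j₀ (p , q) j

  at-↑ : ∀ {j₀ o j} a → At j₀ o j → At j₀ (o ↑ a) (j +ₘ a)
  at-↑ {j₀} {p , q} {j} a (offset lvl) = offset (begin
    j +ₘ a +ₘ q     ≡⟨ +ₘ-assoc j a q ⟩
    j +ₘ (a + q)    ≡⟨ cong (j +ₘ_) (+-comm a q) ⟩
    j +ₘ (q + a)    ≡⟨ +ₘ-assoc j q a ⟨
    j +ₘ q +ₘ a     ≡⟨ cong (_+ₘ a) lvl ⟩
    j₀ +ₘ p +ₘ a    ≡⟨ +ₘ-assoc j₀ p a ⟩
    j₀ +ₘ (p + a)   ∎)

  at-↓ : ∀ {j₀ o i} a → At j₀ o (i +ₘ a) → At j₀ (o ↓ a) i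
  at-↓ {j₀} {p , q} {i} a (offset lvl) = offset (begin
    i +ₘ (q + a)   ≡⟨ cong (i +ₘ_) (+-comm q a) ⟩
    i +ₘ (a + q)   ≡⟨ +ₘ-assoc i a q ⟨
    i +ₘ a +ₘ q    ≡⟨ lvl ⟩
    j₀ +ₘ p        ∎)

  at-same : ∀ {j₀ o o′ j j′} → At j₀ o j → At j₀ o′ j′ → SameOffset o o′ → j ≡ j′
  at-same {j₀} {p , q} {p′ , q′} {j} {j′} (offset lvl) (offset lvl′) same = +ₘ-cancelʳ (q + q′) (begin
    j +ₘ (q + q′)     ≡⟨ +ₘ-assoc j q q′ ⟨
    j +ₘ q +ₘ q′      ≡⟨ cong (_+ₘ q′) lvl ⟩
    j₀ +ₘ p +ₘ q′     ≡⟨ +ₘ-assoc j₀ p q′ ⟩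
    j₀ +ₘ (p + q′)    ≡⟨ cong (j₀ +ₘ_) same ⟩
    j₀ +ₘ (p′ + q)    ≡⟨ +ₘ-assoc j₀ p′ q ⟨
    j₀ +ₘ p′ +ₘ q     ≡⟨ cong (_+ₘ q) lvl′ ⟨
    j′ +ₘ q′ +ₘ q     ≡⟨ +ₘ-assoc j′ q′ q ⟩
    j′ +ₘ (q′ + q)    ≡⟨ cong (j′ +ₘ_) (+-comm q′ q) ⟩
    j′ +ₘ (q + q′)    ∎)

  at-apart : ∀ {M j₀ o} → M ≤ m → Search.Apart M (tabulate darts) pinTable o → ¬ At j₀ o j₀
  at-apart {M} {j₀} {p , q} M≤m (p≢q , p<q+M , q<p+M) (offset lvl) with <-cmp p q
  ... | tri< p<q _ _ = +ₘ-distinct j₀ p<q (<-≤-trans (m≤n∧n<m+o⇒n∸m<o (<⇒≤ p<q) q<p+M) M≤m) (sym lvl)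
  ... | tri≈ _ p≡q _ = p≢q p≡q
  ... | tri> _ _ q<p = +ₘ-distinct j₀ q<p (<-≤-trans (m≤n∧n<m+o⇒n∸m<o (<⇒≤ q<p) p<q+M) M≤m) lvl

  edgeCode-dartOf : ∀ {v j E u} (st : Step v j E u) → edgeCode (dartOf st) ≡ codeOf E
  edgeCode-dartOf (along _ _) = refl
  edgeCode-dartOf (against _ _ _ _) = refl
  edgeCode-dartOf (exit _ _) = refl

  record CycleWalk (n : ℕ) : Set where
    field
      vertex          : ℕ → DV
      edge            : ℕ → DE
      joins           : ∀ t → Joins (edge t) (vertex t) (vertex (suc t))
      closed          : vertex (suc n) ≡ vertex 0
      distinct        : ∀ {s t} → s < t → t < suc n → vertex s ≢ vertex t
      nonBacktracking : ∀ {t} → suc t < suc n → edge t ≢ edge (suc t)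

  Unpinned : DV → Set
  Unpinned (inj₁ _) = ⊤
  Unpinned (inj₂ _) = ⊥

  module Walk (M : ℕ) (M≤m : M ≤ m) (loopless : Loopless) {n} (W : CycleWalk n) where
    open CycleWalk W
    open Search M (tabulate darts) pinTable

    L : ℕ
    L = suc n

    PinAnchored : ℕ → Set
    PinAnchored c₀ = Σ (Fin nP) λ P₀ → toℕ P₀ ≡ c₀ × vertex 0 ≡ inj₂ P₀

    Anchored : Start → Fin m → Set
    Anchored (at c₀) j₀ = Σ (Fin nV) λ v₀ → toℕ v₀ ≡ c₀ × vertex 0 ≡ inj₁ (v₀ , j₀) × (∀ t → t < L → Unpinned (vertex t))
    Anchored (pin c₀) _ = PinAnchored c₀

    Sits : ℕ → Fin m → ℕ × Offset → Set
    Sits t j₀ (c , o) = Σ (Fin nV × Fin m) λ (v , j) → vertex t ≡ inj₁ (v , j) × toℕ v ≡ c × At j₀ o j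

    Visited : ℕ → Fin m → List (ℕ × Offset) → Set
    Visited t j₀ = All (λ x → Σ ℕ λ t′ → t′ ≤ t × Sits t′ j₀ x)

    LastEdge : Maybe EdgeCode → ℕ → Set
    LastEdge l zero = l ≡ nothing
    LastEdge l (suc t) = l ≡ just (codeOf (edge t))

    out-of-fuel : ∀ {t} → L ≤ t + 0 → t < L → ⊥
    out-of-fuel {t} L≤t t<L = <⇒≱ t<L (subst (L ≤_) (+-identityʳ t) L≤t)

    step-at : ∀ {t v j} → vertex t ≡ inj₁ (v , j) → Step v j (edge t) (vertex (suc t))
    step-at {t} vt = step (subst (λ x → Joins (edge t) x (vertex (suc t))) vt (joins t))

    entry-at : ∀ {t P} → vertex t ≡ inj₂ P → Entry P (edge t) (vertex (suc t))
    entry-at {t} vt = entry (subst (λ x → Joins (edge t) x (vertex (suc t))) vt (joins t))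

    fresh : ∀ {t v j l E u} → LastEdge l t → t < L → vertex t ≡ inj₁ (v , j) →
      (st : Step v j E u) → edge t ≡ E → Fresh (edgeCode (dartOf st)) l
    fresh {zero} refl _ _ _ _ = tt
    fresh {suc t} refl t<L vt st eE same = nonBacktracking t<L (sym (trans eE
      (step-unique loopless st back (trans (sym (edgeCode-dartOf st)) same))))
      where
      back = step (swap (subst (Joins (edge t) (vertex t)) vt (joins t)))

    mutual
      explore-sound : ∀ {s f t j₀ c l o h} → T (explore s f c l o h) → Anchored s j₀ → L ≤ t + f → t < L →
        Sits t j₀ (c , o) → Visited t j₀ h → LastEdge l t → ⊥
      explore-sound {f = zero} _ _ L≤ t<L _ _ _ = out-of-fuel L≤ t<L
      explore-sound {s} {suc f} {t} {j₀} {o = o} {h} ex anch L≤ t<L ((v , j) , vt , refl , lvl) vis last =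
        move (step-at vt) refl refl
        where
        L≤′ : L ≤ suc t + f
        L≤′ = subst (L ≤_) (+-suc t f) L≤
        take : ∀ {E u} (st : Step v j E u) → edge t ≡ E → vertex (suc t) ≡ u → T (follow s f (dartOf st) o h) → ⊥
        take (along k _) eE eu next = arrive-sound next anch L≤′ t<L
          ((head k , j +ₘ voltage k) , eu , refl , at-↑ (voltage k) lvl) vis (cong (just ∘ codeOf) (sym eE))
        take (against k i _ i+a≡j) eE eu next = arrive-sound next anch L≤′ t<L
          ((tail k , i) , eu , refl , at-↓ (voltage k) (subst (At j₀ o) (sym i+a≡j) lvl)) vis (cong (just ∘ codeOf) (sym eE))
        take (exit k _) eE eu next = arrivePinned-sound next anch L≤′ t<L eu refl
        move : ∀ {E u} (st : Step v j E u) → edge t ≡ E → vertex (suc t) ≡ u → ⊥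
        move st eE eu = take st eE eu (explore-follow ex (dartOf∈ st) (fresh last t<L vt st eE))

      arrive-sound : ∀ {s f t j₀ c e o h} → T (arrive s f c e o h) → Anchored s j₀ → L ≤ suc t + f → t < L →
        Sits (suc t) j₀ (c , o) → Visited t j₀ h → LastEdge (just e) (suc t) → ⊥
      arrive-sound {s} {f} {t} {j₀} {c} {e} {o} {h} ar anch L≤ t<L sits vis last with m≤n⇒m<n∨m≡n t<L
      ... | inj₂ refl = closing s anch sits (arrive-closes {s} {f} {c} {e} {o} {h} ar)
      ... | inj₁ t+1<L with arrive-continues {s} {f} {c} {e} {o} {h} ar
      ...   | inj₁ rev = revisit (revisits-sound {c} {o} {h} rev) vis sits t+1<L
      ...   | inj₂ ex = explore-sound {s} {f} {suc t} {j₀} {c} {just e} {o} {(c , o) ∷ h} ex anch L≤ t+1<L sits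
                          ((suc t , ≤-refl , sits) ∷ All.map (λ (t′ , t′≤t , s′) → t′ , m≤n⇒m≤1+n t′≤t , s′) vis) last

      arrivePinned-sound : ∀ {s f t j₀ c P} → T (arrivePinned s f c) → Anchored s j₀ → L ≤ suc t + f → t < L →
        vertex (suc t) ≡ inj₂ P → toℕ P ≡ c → ⊥
      arrivePinned-sound {at _} {t = t} _ (_ , _ , v0 , unpinned) _ t<L vt _ with m≤n⇒m<n∨m≡n t<L
      ... | inj₁ t+1<L = subst Unpinned vt (unpinned (suc t) t+1<L)
      ... | inj₂ refl = case trans (sym vt) (trans closed v0) of λ ()
      arrivePinned-sound {pin c₀} {f} {t} {c = c} ar anch@(P₀ , refl , v0) L≤ t<L vt refl
        with arrivePinned-pin {c₀} {f} {c} ar | m≤n⇒m<n∨m≡n t<L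
      ... | P≢P₀ , _ | inj₂ refl = P≢P₀ (cong toℕ (inj₂-injective (trans (sym vt) (trans closed v0))))
      ... | _ , leave | inj₁ t+1<L = leavePinned-sound {c₀} {f} leave anch L≤ t+1<L vt refl

      leavePinned-sound : ∀ {c₀ f t c P} → T (leavePinned (pin c₀) f c) → PinAnchored c₀ → L ≤ t + f → t < L →
        vertex t ≡ inj₂ P → toℕ P ≡ c → ⊥
      leavePinned-sound {f = zero} _ _ L≤ t<L _ _ = out-of-fuel L≤ t<L
      leavePinned-sound {c₀} {suc f} {t} {P = P} leave anch L≤ t<L vt refl =
        go (entry-at vt) refl refl
        where
        go : ∀ {E u} → Entry P E u → edge t ≡ E → vertex (suc t) ≡ u → ⊥
        go (enter k i pk≡P) eE eu = arrive-sound {pin c₀} {f} {j₀ = i}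
          (leavePinned-arrive {pin c₀} {f} {toℕ P} leave (subst (λ x → (toℕ k , toℕ x , toℕ (anchor k)) ∈ pinTable) pk≡P (pinTable∈ k)))
          anch (subst (L ≤_) (+-suc t f) L≤) t<L ((anchor k , i) , eu , refl , offset refl) [] (cong (just ∘ codeOf) (sym eE))

      closing : ∀ {j₀ c o} s → Anchored s j₀ → Sits L j₀ (c , o) → T (closes s c o) → ⊥
      closing (at _) (v₀ , refl , v0 , _) ((v , j) , vL , refl , lvl) cl
        with refl ← inj₁-injective (trans (sym vL) (trans closed v0)) = at-apart M≤m (closes-at cl refl) lvl
      closing (pin _) (_ , _ , v0) (_ , vL , _) _ = case trans (sym vL) (trans closed v0) of λ ()

      revisit : ∀ {t j₀ c o h} → Any (λ (u , o′) → c ≡ u × SameOffset o o′) h → Visited t j₀ h →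
        Sits (suc t) j₀ (c , o) → suc t < L → ⊥
      revisit any vis ((v , j) , vt , refl , lvl) t+1<L with All.lookupAny vis any
      ... | (t′ , t′≤t , ((v′ , j′) , vt′ , v′≡u , lvl′)) , (v≡u , same)
        with refl ← toℕ-injective (trans v≡u (sym v′≡u)) | refl ← at-same lvl lvl′ same =
        distinct (s≤s t′≤t) t+1<L (trans vt′ (sym vt))

    cycle-longer : ∀ {k} → NoShortCycle M k →
      (Σ (Fin nP) λ P → vertex 0 ≡ inj₂ P) ⊎ (∀ t → t < L → Unpinned (vertex t)) → k < L
    cycle-longer {k} certificate start = ≰⇒> λ L≤k → from start L≤k
      where
      fromVertices = proj₁ (Equivalence.to T-∧ certificate)
      fromPins = proj₂ (Equivalence.to T-∧ certificate)
      from : (Σ (Fin nP) λ P → vertex 0 ≡ inj₂ P) ⊎ (∀ t → t < L → Unpinned (vertex t)) → L ≤ k → ⊥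
      from (inj₁ (P , v0)) L≤k = leavePinned-sound {toℕ P} {k} {0}
        (All.lookup (all⁺ _ _ fromPins) (∈-upTo⁺ (toℕ<n P))) (P , refl , v0) L≤k z<s v0 refl
      from (inj₂ unpinned) L≤k = unpinned-start (vertex 0) refl (unpinned 0 z<s)
        where
        unpinned-start : ∀ x → vertex 0 ≡ x → Unpinned x → ⊥
        unpinned-start (inj₁ (v₀ , j₀)) v0 _ = explore-sound {at (toℕ v₀)} {k} {0} {j₀}
          (All.lookup (all⁺ _ _ fromVertices) (∈-upTo⁺ (toℕ<n v₀))) (v₀ , refl , v0 , unpinned) L≤k z<s
          here ((0 , z≤n , here) ∷ []) refl
          where
          here : Sits 0 j₀ (toℕ v₀ , (0 , 0))
          here = (v₀ , j₀) , v0 , refl , offset refl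

  next≡+ₘ1 : ∀ {n} (i : Fin (suc n)) → next i ≡ i +ₘ 1
  next≡+ₘ1 {n} i = toℕ-injective (begin
    toℕ (next i)          ≡⟨ toℕ-fromℕ< _ ⟩
    suc (toℕ i) % suc n   ≡⟨ cong (_% suc n) (+-comm 1 (toℕ i)) ⟩
    (toℕ i + 1) % suc n   ≡⟨ toℕ-+ₘ i 1 ⟨
    toℕ (i +ₘ 1)          ∎)

  rotate : ∀ {n} → Cycle n → Fin (suc n) → CycleWalk n
  rotate {n} c i₀ = record
    { vertex = λ t → vs (i₀ +ₘ t)
    ; edge = λ t → es (i₀ +ₘ t)
    ; joins = λ t → subst (Joins (es (i₀ +ₘ t)) (vs (i₀ +ₘ t)) ∘ vs) (advance t) (joins (i₀ +ₘ t))
    ; closed = cong vs (trans wrap (sym (+ₘ-identityʳ i₀)))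
    ; distinct = λ {s} {t} s<t t<L → +ₘ-distinct i₀ s<t (≤-<-trans (m∸n≤m t s) t<L) ∘ vs-inj
    ; nonBacktracking = λ {t} t+1<L → +ₘ-distinct i₀ (n<1+n t) (≤-<-trans (m∸n≤m (suc t) t) t+1<L) ∘ es-inj
    }
    where
    open Cycle c
    advance : ∀ t → next (i₀ +ₘ t) ≡ i₀ +ₘ suc t
    advance t = trans (next≡+ₘ1 (i₀ +ₘ t)) (trans (+ₘ-assoc i₀ t 1) (cong (i₀ +ₘ_) (+-comm t 1)))
    wrap : i₀ +ₘ suc n ≡ i₀
    wrap = trans (cong (i₀ +ₘ_) (sym (*-identityˡ (suc n)))) (+ₘ-multiple i₀ 1)

  pinned? : (x : DV) → Dec (Σ (Fin nP) λ P → x ≡ inj₂ P)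
  pinned? (inj₁ _) = no λ { (_ , ()) }
  pinned? (inj₂ P) = yes (P , refl)

  unpinned : ∀ x → ¬ (Σ (Fin nP) λ P → x ≡ inj₂ P) → Unpinned x
  unpinned (inj₁ _) _ = tt
  unpinned (inj₂ P) notPinned = notPinned (P , refl)

  girth-bound : ∀ {M k n} → M ≤ m → Loopless → NoShortCycle M k → Cycle n → k < suc n
  girth-bound {M} M≤m loopless certificate c with anyFin? (pinned? ∘ Cycle.vs c)
  ... | yes (i , P , vsi) = Walk.cycle-longer M M≤m loopless (rotate c i) certificate
                              (inj₁ (P , trans (cong (Cycle.vs c) (+ₘ-identityʳ i)) vsi))
  ... | no none = Walk.cycle-longer M M≤m loopless (rotate c fzero) certificate
                    (inj₂ λ t _ → unpinned (Cycle.vs c (fzero +ₘ t)) λ (P , eq) → none (_ , P , eq))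

-- The graph H₁₀

open Graph H10

h10-loopless : Loopless
h10-loopless = toWitness {a? = allFin? λ k → ¬? (tail k ≟ᶠ head k)} tt

h10-baseDegree : ∀ v → baseDegree v ≡ 3
h10-baseDegree = toWitness {a? = allFin? λ v → baseDegree v ≟ 3} tt

h10-pinDegree : ∀ P → pinDegree P ≡ 1
h10-pinDegree = toWitness {a? = allFin? λ P → pinDegree P ≟ 1} tt

h10-noShortCycle : Coding.NoShortCycle H10 6 9
h10-noShortCycle = tt

module TenCycle (k : ℕ) where
  open Derived H10 (suc (suc k))

  cycleVertices : Vec DV 10
  cycleVertices = inj₂ (# 0) ∷ inj₁ (X r , # 0) ∷ inj₁ (X n0 , # 0) ∷ inj₁ (Y n0 , # 0) ∷ inj₁ (Y r , # 0)
                ∷ inj₂ (# 1) ∷ inj₁ (Y r , # 1) ∷ inj₁ (Y n0 , # 1) ∷ inj₁ (X n0 , # 1) ∷ inj₁ (X r , # 1) ∷ []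

  cycleEdges : Vec DE 10
  cycleEdges = inj₂ (# 0 , # 0) ∷ inj₁ (# 0 , # 0) ∷ inj₁ (# 18 , # 0) ∷ inj₁ (# 9 , # 0) ∷ inj₂ (# 1 , # 0)
             ∷ inj₂ (# 1 , # 1) ∷ inj₁ (# 9 , # 1) ∷ inj₁ (# 18 , # 1) ∷ inj₁ (# 0 , # 1) ∷ inj₂ (# 0 , # 1) ∷ []

  injective? : ∀ {A : Set} {n} → DecidableEquality A → (f : Fin n → A) → Dec (∀ i j → f i ≡ f j → i ≡ j)
  injective? _≟_ f = allFin? λ i → allFin? λ j → f i ≟ f j →-dec i ≟ᶠ j

  tenCycle : Cycle 9
  tenCycle = record
    { vs = Vec.lookup cycleVertices
    ; es = Vec.lookup cycleEdges
    ; vs-inj = toWitness {a? = injective? _≟V_ (Vec.lookup cycleVertices)} tt _ _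
    ; es-inj = toWitness {a? = injective? (⊎-≡-dec (×-≡-dec _≟ᶠ_ _≟ᶠ_) (×-≡-dec _≟ᶠ_ _≟ᶠ_)) (Vec.lookup cycleEdges)} tt _ _
    ; joins = toWitness {a? = allFin? λ i → joins? (Vec.lookup cycleEdges i) _ _} tt
    }
    where
    joins? : ∀ E u v → Dec (Joins E u v)
    joins? E u v = ×-≡-dec _≟V_ _≟V_ (ends E) (u , v) ⊎-dec ×-≡-dec _≟V_ _≟V_ (ends E) (v , u)

h10-girth : ∀ m .{{_ : NonZero m}} → 6 ≤ m → Derived.HasGirth H10 m 10
h10-girth m 6≤m@(s≤s (s≤s (s≤s (s≤s (s≤s (s≤s {n = k} _)))))) =
  (9 , refl , TenCycle.tenCycle (4 + k)) , λ _ → Girth.girth-bound H10 m 6≤m h10-loopless h10-noShortCycle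

module H10Degrees (m : ℕ) .{{_ : NonZero m}} where
  open Derived H10 m
  open Degrees H10 m

  deg-unpinned≡3 : ∀ v j → deg (inj₁ (v , j)) ≡ 3
  deg-unpinned≡3 v j = trans (deg-unpinned v j) (h10-baseDegree v)

  deg-pinned≡m : ∀ P → deg (inj₂ P) ≡ m
  deg-pinned≡m P = trans (deg-pinned P) (trans (cong (m *_) (h10-pinDegree P)) (*-identityʳ m))

  deg≡3⊎m : ∀ v → deg v ≡ 3 ⊎ deg v ≡ m
  deg≡3⊎m (inj₁ (v , j)) = inj₁ (deg-unpinned≡3 v j)
  deg≡3⊎m (inj₂ P) = inj₂ (deg-pinned≡m P)

  numOfDegree-m : 3 ≢ m → numOfDegree m ≡ 2
  numOfDegree-m 3≢m = begin
    numOfDegree m                                         ≡⟨ numOfDegree-uniform m deg-unpinned≡3 deg-pinned≡m ⟩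
    20 * (m * indicator (3 ≟ m)) + 2 * indicator (m ≟ m)  ≡⟨ cong₂ (λ x y → 20 * (m * x) + 2 * y)
                                                               (indicator-no (3 ≟ m) 3≢m) (indicator-yes (m ≟ m) refl) ⟩
    20 * (m * 0) + 2 * 1                                  ≡⟨ cong (λ x → 20 * x + 2) (*-zeroʳ m) ⟩
    2                                                     ∎

  numOfDegree-3 : 3 ≢ m → numOfDegree 3 ≡ 20 * m
  numOfDegree-3 3≢m = begin
    numOfDegree 3                                         ≡⟨ numOfDegree-uniform 3 deg-unpinned≡3 deg-pinned≡m ⟩
    20 * (m * indicator (3 ≟ 3)) + 2 * indicator (m ≟ 3)  ≡⟨ cong₂ (λ x y → 20 * (m * x) + 2 * y)
                                                               (indicator-yes (3 ≟ 3) refl) (indicator-no (m ≟ 3) (3≢m ∘ sym)) ⟩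
    20 * (m * 1) + 2 * 0                                  ≡⟨ cong (λ x → 20 * x + 0) (*-identityʳ m) ⟩
    20 * m + 0                                            ≡⟨ +-identityʳ (20 * m) ⟩
    20 * m                                                ∎

theorem4 : (m : ℕ) .{{_ : NonZero m}} → 6 ≤ m →
    Derived.Is3mGraph H10 m 10
    × Derived.numOfDegree H10 m m ≡ 2
    × Derived.numOfDegree H10 m 3 ≡ 20 * m
theorem4 m 6≤m = (h10-girth m 6≤m , deg≡3⊎m) , numOfDegree-m 3≢m , numOfDegree-3 3≢m
  where
  open H10Degrees m
  3≢m : 3 ≢ m
  3≢m refl = contradiction 6≤m λ { (s≤s (s≤s (s≤s ()))) }
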